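{- Consider the file-bundle caching problem with a single cache of size $k$ and queries of length $l$ (with $1\le l\le k$), as defined in the context. (i) No deterministic online algorithm for the file-bundle caching problem can achieve a competitive ratio better than $k-l+1$. (ii) The LRU algorithm has a competitive ratio of $k$; that is, there is a constant $c$ independent of $\sigma$ such that for every query sequence $\sigma$, $\mathrm{LRU}(\sigma)\le k\cdot \mathrm{OPT}(\sigma)+c$.
   Context: File-bundle caching problem: there is a set of pages $\mathcal{O}=\{1,\dots,N\}$ (with $N$ large compared to $k$), each of unit size, and a single cache of size $k$ whose content at time $t=1,2,\dots,T$ is $C_t\subset\mathcal{O}$ with $|C_t|=k$. At each time $t$ a query $Q_t\subset\mathcal{O}$ with $|Q_t|=l$ arrives and must be answered immediately by $C_t$. The cost at time $t$ is $f(C_t,Q_t)=\mathbb{1}_{\{Q_t\not\subseteq C_t\}}$ (a cache miss occurs if at least one page of the query is not in the cache). Upon a cache miss, the algorithm must update the cache to $C_{t+1}$ by inserting the pages of $Q_t$ and evicting some current pages, before $Q_{t+1}$ arrives; no other changes to the cache are allowed. An online algorithm makes its decisions without knowledge of future queries; the optimal offline algorithm $\mathrm{OPT}$ (with a cache of size $k$) knows the whole sequence. For a sequence $\sigma=\{Q_t\}_{t=1}^T$, $\mathrm{ALG}(\sigma)=\sum_t f(C_t,Q_t)$. An algorithm has competitive ratio $r$ if for every sequence $\sigma$, $\mathrm{ALG}(\sigma)\le r\cdot\mathrm{OPT}(\sigma)+c$ with $c$ a constant independent of $\sigma$. LRU (least recently used): whenever requested pages are not in the cache, they are put into the cache, evicting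 the least recently used pages (the pages whose most recent request was earliest). -}

module Defs where

open import Data.Nat using (ℕ; zero; suc; _+_; _*_; _∸_; _≤_; _<_; _≟_)
open import Data.List using (List; []; _∷_; _++_; [_]; length; take; filter)
open import Data.List.Relation.Unary.All using (All; all?)
open import Data.List.Relation.Unary.Unique.Propositional using (Unique)
open import Data.List.Membership.DecPropositional _≟_ using (_∈_; _∈?_)
open import Data.Product using (Σ; ∃; _×_; proj₁; proj₂)
open import Data.Sum using (_⊎_)
open import Relation.Nullary using (¬_; yes; no; ¬?)
open import Relation.Binary.PropositionalEquality using (_≡_)

-- Pages are natural numbers: the page universe is unbounded
-- (models "N large compared to k").
Page : Set
Page = ℕ

record PageSet (n : ℕ) : Set where
  constructor mkPageSet
  field
    pages  : List Page
    unique : Unique pages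
    size   : length pages ≡ n
open PageSet public

Cache : ℕ → Set
Cache k = PageSet k

Query : ℕ → Set
Query l = PageSet l

_⊆ₚ_ : List Page → List Page → Set
xs ⊆ₚ ys = All (_∈ ys) xs

miss : List Page → List Page → ℕ
miss C Q with all? (_∈? C) Q
... | yes _ = 0
... | no  _ = 1

-- Allowed update C → C' upon query Q: the pages of Q are inserted and
-- C' contains only pages of C or of Q (on a hit this forces C' = C as sets).
Transition : ∀ {k l} → Cache k → Query l → Cache k → Set
Transition C Q C' =
  (pages Q ⊆ₚ pages C') × (∀ p → p ∈ pages C' → (p ∈ pages C) ⊎ (p ∈ pages Q))

data Schedule {k l : ℕ} (C : Cache k) : List (Query l) → Set where
  done : Schedule C []
  step : ∀ {Q σ} (C' : Cache k) → Transition C Q C' → Schedule C' σ → Schedule C (Q ∷ σ)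

cost : ∀ {k l} {C : Cache k} {σ : List (Query l)} → Schedule C σ → ℕ
cost done = 0
cost {C = C} (step {Q = Q} C' _ s) = miss (pages C) (pages Q) + cost s

-- A deterministic online algorithm: initial cache and an update rule which
-- may depend on the whole past (history of queries), the current cache and
-- the current query, but not on future queries.
record OnlineAlg (k l : ℕ) : Set where
  field
    init : Cache k
    next : List (Query l) → (C : Cache k) → (Q : Query l) → Σ (Cache k) (Transition C Q)
open OnlineAlg public

run : ∀ {k l} (A : OnlineAlg k l) → List (Query l) → (C : Cache k) → (σ : List (Query l)) → Schedule C σ
run A h C [] = done
run A h C (Q ∷ σ) = step (proj₁ (next A h C Q)) (proj₂ (next A h C Q)) (run A (h ++ [ Q ]) (proj₁ (next A h C Q)) σ)

algCost : ∀ {k l} → OnlineAlg k l → List (Query l) → ℕ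
algCost A σ = cost (run A [] (init A) σ)

-- A achieves competitive ratio p/q (q > 0):  ALG(σ) ≤ (p/q)·OPT(σ) + c,
-- i.e. q·ALG(σ) ≤ p·cost(S) + c' for every feasible schedule S (OPT = min cost S),
-- OPT starting from the same initial cache.
AchievesRatio : ∀ {k l} → OnlineAlg k l → ℕ → ℕ → Set
AchievesRatio {k} {l} A p q =
  ∃ λ c → ∀ (σ : List (Query l)) (S : Schedule (init A) σ) → q * algCost A σ ≤ p * cost S + c

-- The cache is kept as a list ordered by recency (most recent first).
lruStep : List Page → List Page → List Page
lruStep C Q = take (length C) (Q ++ filter (λ p → ¬? (p ∈? Q)) C)

lruCost : ∀ {l} → List Page → List (Query l) → ℕ
lruCost C [] = 0
lruCost C (Q ∷ σ) = miss C (pages Q) + lruCost (lruStep C (pages Q)) σ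

module Submission where

-- Let U be the algorithm's initial cache plus one fresh page and fix a set B of l − 1 pages
-- of U. As |U| = k + 1, some page of U is missing from the online cache, and the adversary requests a
-- bundle x ∷ B containing it, so the algorithm faults on every request. Any s = k − l + 1 consecutive
-- requests touch at most s + (l − 1) = k pages of U, so an offline cache that on each fault switches to
-- U minus a page not requested in the next s requests faults at most once every s requests.
--
-- The pages requested in the current LRU phase form the front of LRU's recency list, and a
-- phase ends when they would exceed k pages. Each LRU fault lengthens the front, so LRU faults at most k
-- times per phase. If OPT has not faulted during a phase it holds the whole front, and then the request
-- that overflows the phase is an OPT fault; thus each completed phase is matched by an OPT fault. In
-- amortised form: lruCost + |front| ≤ k · OPT + k + credit, the credit being k once OPT has faulted in
-- the current phase.

open import Defs
open import Function using (_∘_; case_of_)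
open import Data.Nat using (ℕ; zero; suc; _+_; _*_; _∸_; _≤_; _<_; _≟_; z≤n; s≤s; s≤s⁻¹)
open import Data.Nat.Properties
open import Data.Nat.Tactic.RingSolver using (solve-∀)
open import Data.Nat.ListAction using (sum)
open import Data.List using (List; []; _∷_; _++_; [_]; length; take; filter)
open import Data.List.Properties using (filter-notAll; filter-++; ++-assoc; length-++; length-++-≤ˡ; length-take)
import Data.List.Relation.Unary.All as All
open All using (All; []; _∷_; all?)
import Data.List.Relation.Unary.All.Properties as Allₚ
import Data.List.Relation.Unary.Unique.Propositional.Properties as Uniqueₚ
import Data.List.Relation.Unary.Any as Any
open Any using (here; there)
open import Data.List.Relation.Unary.AllPairs using ([]; _∷_)
open import Data.List.Relation.Unary.Unique.Propositional using (Unique)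
open import Data.List.Membership.DecPropositional _≟_ using (_∈_; _∉_; _∈?_; _∉?_; find)
open import Data.List.Membership.Propositional.Properties using (∈-filter⁺; ∈-filter⁻; ∈-++⁺ˡ; ∈-++⁺ʳ)
open import Data.Product using (Σ; ∃; _×_; _,_; proj₁; proj₂)
open import Data.Sum using (_⊎_; inj₁; inj₂)
open import Level using (0ℓ)
open import Relation.Unary using (Pred; Decidable)
open import Relation.Unary.Properties using (∁?)
open import Relation.Nullary using (Dec; ¬_; yes; no; ¬?; contradiction)
open import Relation.Binary.PropositionalEquality
  using (_≡_; _≢_; refl; sym; trans; cong; cong₂; subst; subst₂; module ≡-Reasoning)

_≢?_ : (p q : Page) → Dec (p ≢ q)
p ≢? q = ¬? (p ≟ q)

pigeonhole : ∀ {xs ys : List Page} → Unique xs → xs ⊆ₚ ys → length xs ≤ length ys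
pigeonhole {[]} _ _ = z≤n
pigeonhole {x ∷ xs} {ys} (x∉xs ∷ xs!) (x∈ys ∷ xs⊆ys) = begin
  suc (length xs)                   ≤⟨ s≤s (pigeonhole xs! xs⊆ys-x) ⟩
  suc (length (filter (_≢? x) ys))  ≤⟨ filter-notAll (_≢? x) ys (Any.map (λ x≡y y≢x → y≢x (sym x≡y)) x∈ys) ⟩
  length ys                         ∎
  where
  open ≤-Reasoning
  xs⊆ys-x : xs ⊆ₚ filter (_≢? x) ys
  xs⊆ys-x = All.zipWith (λ (y∈ys , x≢y) → ∈-filter⁺ (_≢? x) y∈ys (x≢y ∘ sym)) (xs⊆ys , x∉xs)

∃-∉ : ∀ {xs ys : List Page} → Unique xs → length ys < length xs → ∃ λ x → x ∈ xs × x ∉ ys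
∃-∉ {xs} {ys} xs! ys<xs with all? (_∈? ys) xs
... | yes xs⊆ys = contradiction (pigeonhole xs! xs⊆ys) (<⇒≱ ys<xs)
... | no  xs⊈ys = find (Allₚ.¬All⇒Any¬ (_∈? ys) xs xs⊈ys)

⊆-by-length : ∀ {xs ys : List Page} → Unique ys → ys ⊆ₚ xs → length xs ≤ length ys → xs ⊆ₚ ys
⊆-by-length {xs} {ys} ys! ys⊆xs xs≤ys = All.tabulate covered
  where
  covered : ∀ {x} → x ∈ xs → x ∈ ys
  covered {x} x∈xs with x ∈? ys
  ... | yes x∈ys = x∈ys
  ... | no  x∉ys = contradiction (≤-trans (pigeonhole x∷ys! (x∈xs ∷ ys⊆xs)) xs≤ys) (<-irrefl refl)
    where
    x∷ys! : Unique (x ∷ ys)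
    x∷ys! = All.tabulate (λ y∈ys x≡y → x∉ys (subst (_∈ ys) (sym x≡y) y∈ys)) ∷ ys!

length-filter+length-filter-∁ : ∀ {A : Set} {P : Pred A 0ℓ} (P? : Decidable P) xs →
                                length (filter P? xs) + length (filter (∁? P?) xs) ≡ length xs
length-filter+length-filter-∁ P? [] = refl
length-filter+length-filter-∁ P? (x ∷ xs) with P? x
... | yes _ = cong suc (length-filter+length-filter-∁ P? xs)
... | no  _ = trans (+-suc _ _) (cong suc (length-filter+length-filter-∁ P? xs))

take-++ : ∀ {A : Set} n (xs ys : List A) → length xs ≤ n → take n (xs ++ ys) ≡ xs ++ take (n ∸ length xs) ys
take-++ n       []       ys _        = refl
take-++ (suc n) (x ∷ xs) ys (s≤s le) = cong (x ∷_) (take-++ n xs ys le)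

Unique-++⁻ˡ : ∀ {A : Set} (xs : List A) {ys} → Unique (xs ++ ys) → Unique xs
Unique-++⁻ˡ []       _            = []
Unique-++⁻ˡ (x ∷ xs) (x∉ ∷ xs++ys!) = Allₚ.++⁻ˡ xs x∉ ∷ Unique-++⁻ˡ xs xs++ys!

miss-hit : ∀ {C Q : List Page} → Q ⊆ₚ C → miss C Q ≡ 0
miss-hit {C} {Q} Q⊆C with all? (_∈? C) Q
... | yes _   = refl
... | no  Q⊈C = contradiction Q⊆C Q⊈C

miss-fault : ∀ {C Q : List Page} → ¬ Q ⊆ₚ C → miss C Q ≡ 1
miss-fault {C} {Q} Q⊈C with all? (_∈? C) Q
... | yes Q⊆C = contradiction Q⊆C Q⊈C
... | no  _   = refl

miss≤1 : ∀ C Q → miss C Q ≤ 1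
miss≤1 C Q with all? (_∈? C) Q
... | yes _ = z≤n
... | no  _ = ≤-refl

hit-keeps-cache : ∀ {k l} {C C′ : Cache k} {Q : Query l} → Transition C Q C′ → pages Q ⊆ₚ pages C →
                  pages C ⊆ₚ pages C′
hit-keeps-cache {C = C} {C′} (_ , from-C-or-Q) Q⊆C =
  ⊆-by-length (unique C′) C′⊆C (≤-reflexive (trans (size C) (sym (size C′))))
  where
  C′⊆C : pages C′ ⊆ₚ pages C
  C′⊆C = All.tabulate λ {p} p∈C′ → case from-C-or-Q p p∈C′ of λ where
    (inj₁ p∈C) → p∈C
    (inj₂ p∈Q) → All.lookup Q⊆C p∈Q

keep : ∀ {k l σ} (C : Cache k) (Q : Query l) → pages Q ⊆ₚ pages C → Schedule C σ → Schedule C (Q ∷ σ)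
keep C Q Q⊆C = step C (Q⊆C , λ _ p∈C → inj₁ p∈C)

cost-keep : ∀ {k l σ} (C : Cache k) (Q : Query l) (Q⊆C : pages Q ⊆ₚ pages C) (S : Schedule C σ) →
            cost (keep C Q Q⊆C S) ≡ cost S
cost-keep C Q Q⊆C S = cong (_+ cost S) (miss-hit Q⊆C)

cost-fault : ∀ {k l σ} (C : Cache k) (Q : Query l) {C′} (tr : Transition C Q C′) (S : Schedule C′ σ) →
             ¬ pages Q ⊆ₚ pages C → cost {C = C} (step {Q = Q} C′ tr S) ≡ suc (cost S)
cost-fault C Q tr S Q⊈C = cong (_+ cost S) (miss-fault Q⊈C)

∈⇒≤sum : ∀ {n ns} → n ∈ ns → n ≤ sum ns
∈⇒≤sum {ns = n ∷ ns} (here refl) = m≤m+n n (sum ns)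
∈⇒≤sum {ns = m ∷ ns} (there n∈ns) = ≤-trans (∈⇒≤sum n∈ns) (m≤n+m (sum ns) m)

suc-sum-∉ : ∀ ns → suc (sum ns) ∉ ns
suc-sum-∉ ns n∈ns = <-irrefl refl (∈⇒≤sum n∈ns)

*-cancelˡ-≤-slack : ∀ r c n → suc r * c ≤ n * suc r + r → c ≤ n
*-cancelˡ-≤-slack r c n bound = s≤s⁻¹ (*-cancelˡ-< (suc r) c (suc n) (begin-strict
  suc r * c        ≤⟨ bound ⟩
  n * suc r + r    <⟨ +-monoʳ-< (n * suc r) (n<1+n r) ⟩
  n * suc r + suc r ≡⟨ +-comm (n * suc r) (suc r) ⟩
  suc n * suc r    ≡⟨ *-comm (suc n) (suc r) ⟩
  suc r * suc n    ∎))
  where open ≤-Reasoning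

module LowerBound (k b : ℕ) (b<k : b < k) (A : OnlineAlg k (suc b))
                  (U : List Page) (U! : Unique U) (length-U : length U ≡ suc k)
                  (y₀ : Page) (init⊇U∖y₀ : ∀ {p} → p ∈ U → p ≢ y₀ → p ∈ pages (init A)) where

  r : ℕ
  r = k ∸ suc b

  cache<U : ∀ (C : Cache k) → length (pages C) < length U
  cache<U C = subst (length (pages C) <_) (sym length-U) (s≤s (≤-reflexive (size C)))

  B : List Page
  B = take b U

  B⊆U : B ⊆ₚ U
  B⊆U = Allₚ.take⁺ b (All.tabulate (λ p∈U → p∈U))

  length-B : length B ≡ b
  length-B = trans (length-take b U)
                   (m≤n⇒m⊓n≡m (≤-trans (m≤n⇒m≤1+n (<⇒≤ b<k)) (≤-reflexive (sym length-U))))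

  outside-B : ∃ λ x → x ∈ U × x ∉ B
  outside-B = ∃-∉ U! (subst (length B <_) (sym length-U) (s≤s (≤-trans (≤-reflexive length-B) (<⇒≤ b<k))))

  query : (x : Page) → x ∉ B → Query (suc b)
  query x x∉B = mkPageSet (x ∷ B)
    (All.tabulate (λ y∈B x≡y → x∉B (subst (_∈ B) (sym x≡y) y∈B)) ∷ Uniqueₚ.take⁺ b U!)
    (cong suc length-B)

  record Adversarial (Q : Query (suc b)) : Set where
    constructor adversarial
    field
      extra   : Page
      extra∈U : extra ∈ U
      shape   : pages Q ≡ extra ∷ B

  adversarial⊆U : ∀ {Q} → Adversarial Q → pages Q ⊆ₚ U
  adversarial⊆U {Q} (adversarial x x∈U Q≡x∷B) = subst (_⊆ₚ U) (sym Q≡x∷B) (x∈U ∷ B⊆U)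

  fault-query : (C : Cache k) → Σ (Query (suc b)) λ Q → Adversarial Q × ¬ pages Q ⊆ₚ pages C
  fault-query C with ∃-∉ U! (cache<U C)
  ... | m , m∈U , m∉C with m ∈? B
  ...   | no m∉B = query m m∉B , adversarial m m∈U refl , λ Q⊆C → m∉C (All.lookup Q⊆C (here refl))
  ...   | yes m∈B with outside-B
  ...     | x , x∈U , x∉B = query x x∉B , adversarial x x∈U refl , λ Q⊆C → m∉C (All.lookup Q⊆C (there m∈B))

  adversary : List (Query (suc b)) → Cache k → ℕ → List (Query (suc b))
  adversary h C zero    = []
  adversary h C (suc n) = Q ∷ adversary (h ++ [ Q ]) (proj₁ (next A h C Q)) n
    where Q = proj₁ (fault-query C)

  length-adversary : ∀ h C n → length (adversary h C n) ≡ n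
  length-adversary h C zero    = refl
  length-adversary h C (suc n) = cong suc (length-adversary _ _ n)

  adversary-adversarial : ∀ h C n → All Adversarial (adversary h C n)
  adversary-adversarial h C zero    = []
  adversary-adversarial h C (suc n) = proj₁ (proj₂ (fault-query C)) ∷ adversary-adversarial _ _ n

  cost-adversary : ∀ h C n → cost (run A h C (adversary h C n)) ≡ n
  cost-adversary h C zero    = refl
  cost-adversary h C (suc n) =
    cong₂ _+_ (miss-fault (proj₂ (proj₂ (fault-query C)))) (cost-adversary _ _ n)

  U-except : Page → List Page
  U-except z = filter (_≢? z) U

  ∈-U-except : ∀ y {p} → p ∈ U → p ≢ y → p ∈ U-except y
  ∈-U-except y = ∈-filter⁺ (_≢? y)

  U-except⊆U : ∀ y {p} → p ∈ U-except y → p ∈ U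
  U-except⊆U y = proj₁ ∘ ∈-filter⁻ (_≢? y)

  cache-except : ∀ {z} → z ∈ U → Cache k
  cache-except {z} z∈U = mkPageSet (U-except z) (Uniqueₚ.filter⁺ (_≢? z) U!) (≤-antisym shorter longer)
    where
    shorter : length (U-except z) ≤ k
    shorter = s≤s⁻¹ (subst (length (U-except z) <_) length-U
      (filter-notAll (_≢? z) U (Any.map (λ z≡p p≢z → p≢z (sym z≡p)) z∈U)))
    U⊆z∷U-except : U ⊆ₚ (z ∷ U-except z)
    U⊆z∷U-except = All.tabulate λ {p} p∈U → case p ≟ z of λ where
      (yes refl) → here refl
      (no  p≢z)  → there (∈-U-except z p∈U p≢z)
    longer : k ≤ length (U-except z)
    longer = s≤s⁻¹ (subst (_≤ suc (length (U-except z))) length-U (pigeonhole U! U⊆z∷U-except))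

  _⊇U∖_ : Cache k → Page → Set
  C ⊇U∖ y = ∀ {p} → p ∈ U → p ≢ y → p ∈ pages C

  cache-except-⊇ : ∀ {z} (z∈U : z ∈ U) → cache-except z∈U ⊇U∖ z
  cache-except-⊇ {z} _ = ∈-U-except z

  hit-if-avoids : ∀ {C : Cache k} {y Q} → C ⊇U∖ y → Adversarial Q → y ∉ pages Q → pages Q ⊆ₚ pages C
  hit-if-avoids {Q = Q} C⊇ adv y∉Q = All.tabulate λ q∈Q →
    C⊇ (All.lookup (adversarial⊆U adv) q∈Q) (λ q≡y → y∉Q (subst (_∈ pages Q) q≡y q∈Q))

  evict : ∀ {C : Cache k} {y z Q} (z∈U : z ∈ U) → C ⊇U∖ y → Adversarial Q →
          ¬ pages Q ⊆ₚ pages C → z ∉ pages Q → Transition C Q (cache-except z∈U)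
  evict {C} {y} {z} {Q} z∈U C⊇ adv Q⊈C z∉Q = Q⊆U-except , from-C-or-Q
    where
    Q⊆U-except : pages Q ⊆ₚ U-except z
    Q⊆U-except = All.tabulate λ {q} q∈Q →
      ∈-U-except z (All.lookup (adversarial⊆U adv) q∈Q) (λ q≡z → z∉Q (subst (_∈ pages Q) q≡z q∈Q))
    y∈Q : y ∈ pages Q
    y∈Q with y ∈? pages Q
    ... | yes y∈Q = y∈Q
    ... | no  y∉Q = contradiction (hit-if-avoids {C} C⊇ adv y∉Q) Q⊈C
    from-C-or-Q : ∀ p → p ∈ U-except z → p ∈ pages C ⊎ p ∈ pages Q
    from-C-or-Q p p∈U-except with p ≟ y
    ... | yes refl = inj₂ y∈Q
    ... | no  p≢y  = inj₁ (C⊇ (U-except⊆U z p∈U-except) p≢y)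

  cover : ∀ {τ} → All Adversarial τ → ∃ λ xs → length xs ≡ length τ × All (λ Q → pages Q ⊆ₚ (xs ++ B)) τ
  cover [] = [] , refl , []
  cover {Q ∷ _} (adversarial x _ Q≡x∷B ∷ advs) with cover advs
  ... | xs , length-xs , covered =
    x ∷ xs , cong suc length-xs ,
    subst (_⊆ₚ (x ∷ xs ++ B)) (sym Q≡x∷B) (here refl ∷ All.tabulate (λ p∈B → there (∈-++⁺ʳ xs p∈B))) ∷
    All.map (All.map there) covered

  window-fill : suc r + b ≡ k
  window-fill = trans (sym (+-suc r b)) (m∸n+n≡m b<k)

  unused-in-window : ∀ {τ} → All Adversarial τ → length τ ≤ suc r →
                     ∃ λ z → z ∈ U × All (λ Q → z ∉ pages Q) τ
  unused-in-window {τ} advs τ≤window with cover advs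
  ... | xs , length-xs , covered with ∃-∉ U! cover<U
    where
    cover<U : length (xs ++ B) < length U
    cover<U = begin-strict
      length (xs ++ B)     ≡⟨ length-++ xs ⟩
      length xs + length B ≡⟨ cong₂ _+_ length-xs length-B ⟩
      length τ + b         ≤⟨ +-monoˡ-≤ b τ≤window ⟩
      suc r + b            ≡⟨ window-fill ⟩
      k                    <⟨ n<1+n k ⟩
      suc k                ≡⟨ length-U ⟨
      length U             ∎
      where open ≤-Reasoning
  ... | z , z∈U , z∉cover = z , z∈U , All.map (λ Q⊆cover z∈Q → z∉cover (All.lookup Q⊆cover z∈Q)) covered

  -- j counts the upcoming queries known to avoid the page y missing from C. On a fault the schedule
  -- evicts a page unused by the next r + 1 queries, so it faults at most once per r + 1 queries.
  WindowBound : ℕ → ℕ → ℕ → Set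
  WindowBound j n c = j + suc r * c ≤ n + r

  lookahead : ∀ (σ : List (Query (suc b))) → All Adversarial σ → (C : Cache k) (y : Page) → C ⊇U∖ y →
              (j : ℕ) → j ≤ r → All (λ Q → y ∉ pages Q) (take j σ) →
              Σ (Schedule C σ) λ S → WindowBound j (length σ) (cost S)
  lookahead [] _ C y _ j j≤r _ = done , (begin
    j + suc r * 0 ≡⟨ cong (j +_) (*-zeroʳ (suc r)) ⟩
    j + 0         ≡⟨ +-identityʳ j ⟩
    j             ≤⟨ j≤r ⟩
    r             ∎)
    where open ≤-Reasoning
  lookahead (Q ∷ σ) (adv ∷ advs) C y C⊇ (suc j) j<r (y∉Q ∷ avoids)
    with lookahead σ advs C y C⊇ j (<⇒≤ j<r) avoids
  ... | S , bound =
    keep C Q Q⊆C S , subst (WindowBound (suc j) (suc (length σ))) (sym (cost-keep C Q Q⊆C S)) (s≤s bound)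
    where Q⊆C = hit-if-avoids {C} C⊇ adv y∉Q
  lookahead (Q ∷ σ) (adv ∷ advs) C y C⊇ zero _ _ with all? (_∈? pages C) (pages Q)
  ... | yes Q⊆C with lookahead σ advs C y C⊇ 0 z≤n []
  ...   | S , bound =
    keep C Q Q⊆C S , subst (WindowBound 0 (suc (length σ))) (sym (cost-keep C Q Q⊆C S)) (m≤n⇒m≤1+n bound)
  lookahead (Q ∷ σ) (adv ∷ advs) C y C⊇ zero _ _
      | no Q⊈C
      with unused-in-window (adv ∷ Allₚ.take⁺ r advs) (s≤s (≤-trans (≤-reflexive (length-take r σ)) (m⊓n≤m r _)))
  ... | z , z∈U , z∉Q ∷ avoids
      with lookahead σ advs (cache-except z∈U) z (cache-except-⊇ z∈U) r ≤-refl avoids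
  ...   | S , bound =
    step (cache-except z∈U) evicted S ,
    subst (WindowBound 0 (suc (length σ))) (sym (cost-fault C Q evicted S Q⊈C)) (begin
      suc r * suc (cost S)     ≡⟨ *-suc (suc r) (cost S) ⟩
      suc r + suc r * cost S   ≤⟨ s≤s bound ⟩
      suc (length σ + r)       ∎)
    where
    open ≤-Reasoning
    evicted = evict {C} {Q = Q} z∈U C⊇ adv Q⊈C z∉Q

  not-competitive : ∀ p q → p < suc r * q → ¬ AchievesRatio A p q
  not-competitive p q p<ratio (c , competitive) = <-irrefl refl (≤-trans opt<alg (competitive σ S))
    where
    N : ℕ
    N = suc c
    σ : List (Query (suc b))
    σ = adversary [] (init A) (N * suc r)
    opt : Σ (Schedule (init A) σ) λ S → WindowBound 0 (length σ) (cost S)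
    opt = lookahead σ (adversary-adversarial [] (init A) (N * suc r)) (init A) y₀ init⊇U∖y₀ 0 z≤n []
    S : Schedule (init A) σ
    S = proj₁ opt
    cost-S≤N : cost S ≤ N
    cost-S≤N = *-cancelˡ-≤-slack r (cost S) N
      (subst (λ n → suc r * cost S ≤ n + r) (length-adversary [] (init A) (N * suc r)) (proj₂ opt))
    opt<alg : p * cost S + c < q * algCost A σ
    opt<alg = begin-strict
      p * cost S + c  <⟨ s≤s (+-monoˡ-≤ c (*-monoʳ-≤ p cost-S≤N)) ⟩
      suc (p * N + c) ≡⟨ cong suc (+-comm (p * N) c) ⟩
      suc p * N       ≤⟨ *-monoˡ-≤ N p<ratio ⟩
      suc r * q * N   ≡⟨ cong (_* N) (*-comm (suc r) q) ⟩
      q * suc r * N   ≡⟨ *-assoc q (suc r) N ⟩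
      q * (suc r * N) ≡⟨ cong (q *_) (*-comm (suc r) N) ⟩
      q * (N * suc r) ≡⟨ cong (q *_) (cost-adversary [] (init A) (N * suc r)) ⟨
      q * algCost A σ ∎
      where open ≤-Reasoning

no-ratio-below : ∀ k l → 1 ≤ l → l ≤ k → (A : OnlineAlg k l) (p q : ℕ) →
                 p < (k ∸ l + 1) * q → ¬ AchievesRatio A p q
no-ratio-below k (suc b) _ b<k A p q p<ratio =
  LowerBound.not-competitive k b b<k A (e ∷ I) e∷I! (cong suc (size (init A))) e init⊇ p q
    (subst (λ s → p < s * q) (+-comm (k ∸ suc b) 1) p<ratio)
  where
  I : List Page
  I = pages (init A)
  e : Page
  e = suc (sum I)
  e∷I! : Unique (e ∷ I)
  e∷I! = All.tabulate (λ i∈I e≡i → suc-sum-∉ I (subst (_∈ I) (sym e≡i) i∈I)) ∷ unique (init A)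
  init⊇ : ∀ {p} → p ∈ e ∷ I → p ≢ e → p ∈ I
  init⊇ (here refl)  p≢e = contradiction refl p≢e
  init⊇ (there p∈I) _   = p∈I

moveToFront : List Page → List Page → List Page
moveToFront Q xs = Q ++ filter (_∉? Q) xs

Unique-moveToFront : ∀ {Q xs} → Unique Q → Unique xs → Unique (moveToFront Q xs)
Unique-moveToFront {Q} {xs} Q! xs! =
  Uniqueₚ.++⁺ Q! (Uniqueₚ.filter⁺ (_∉? Q) xs!)
    (λ (v∈Q , v∈rest) → proj₂ (∈-filter⁻ (_∉? Q) {xs = xs} v∈rest) v∈Q)

miss+queried≤length : ∀ {L P} Q → Unique P → P ⊆ₚ L → miss L Q + length (filter (_∈? Q) P) ≤ length Q
miss+queried≤length {L} {P} Q P! P⊆L with all? (_∈? L) Q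
... | yes _ = pigeonhole (Uniqueₚ.filter⁺ (_∈? Q) P!) (Allₚ.all-filter (_∈? Q) P)
... | no Q⊈L with find (Allₚ.¬All⇒Any¬ (_∈? L) Q Q⊈L)
...   | q , q∈Q , q∉L =
  pigeonhole (q∉queried ∷ Uniqueₚ.filter⁺ (_∈? Q) P!) (q∈Q ∷ Allₚ.all-filter (_∈? Q) P)
  where
  q∉queried : All (q ≢_) (filter (_∈? Q) P)
  q∉queried = All.tabulate λ y∈queried q≡y →
    q∉L (All.lookup P⊆L (subst (_∈ P) (sym q≡y) (proj₁ (∈-filter⁻ (_∈? Q) y∈queried))))

miss+length≤length-moveToFront : ∀ {L P} Q → Unique P → P ⊆ₚ L → miss L Q + length P ≤ length (moveToFront Q P)
miss+length≤length-moveToFront {L} {P} Q P! P⊆L = begin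
  miss L Q + length P                                  ≡⟨ cong (miss L Q +_) (length-filter+length-filter-∁ (_∈? Q) P) ⟨
  miss L Q + (length queried + length (filter (_∉? Q) P)) ≡⟨ +-assoc (miss L Q) _ _ ⟨
  miss L Q + length queried + length (filter (_∉? Q) P)   ≤⟨ +-monoˡ-≤ _ (miss+queried≤length Q P! P⊆L) ⟩
  length Q + length (filter (_∉? Q) P)                    ≡⟨ length-++ Q ⟨
  length (moveToFront Q P)                                ∎
  where
  open ≤-Reasoning
  queried = filter (_∈? Q) P

moveToFront-⊆ : ∀ {Q P D} → Q ⊆ₚ D → P ⊆ₚ D → moveToFront Q P ⊆ₚ D
moveToFront-⊆ {Q} Q⊆D P⊆D = Allₚ.++⁺ Q⊆D (Allₚ.filter⁺ (_∉? Q) P⊆D)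

lruStep-continues : ∀ {L} P R Q → L ≡ P ++ R → length (moveToFront Q P) ≤ length L →
                    ∃ λ R′ → lruStep L Q ≡ moveToFront Q P ++ R′
lruStep-continues P R Q refl fits = _ , (begin
  take n (Q ++ filter (_∉? Q) (P ++ R))                    ≡⟨ cong (λ t → take n (Q ++ t)) (filter-++ (_∉? Q) P R) ⟩
  take n (Q ++ filter (_∉? Q) P ++ filter (_∉? Q) R)       ≡⟨ cong (take n) (++-assoc Q _ _) ⟨
  take n (moveToFront Q P ++ filter (_∉? Q) R)             ≡⟨ take-++ n (moveToFront Q P) _ fits ⟩
  moveToFront Q P ++ take (n ∸ length (moveToFront Q P)) (filter (_∉? Q) R) ∎)
  where
  open ≡-Reasoning
  n = length (P ++ R)

lruStep-restarts : ∀ L Q → length Q ≤ length L → ∃ λ R′ → lruStep L Q ≡ Q ++ R′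
lruStep-restarts L Q fits = _ , take-++ (length L) Q _ fits

lruNext : ∀ {k l} → Cache k → Query l → Cache k
lruNext L Q = mkPageSet (lruStep (pages L) (pages Q))
  (Uniqueₚ.take⁺ _ (Unique-moveToFront (unique Q) (unique L)))
  (trans (length-take _ (moveToFront (pages Q) (pages L))) (trans (m≤n⇒m⊓n≡m L≤) (size L)))
  where
  L≤ : length (pages L) ≤ length (moveToFront (pages Q) (pages L))
  L≤ = m+n≤o⇒n≤o _ (miss+length≤length-moveToFront (pages Q) (unique L) (All.tabulate (λ p∈L → p∈L)))

settle-bound : ∀ x y o d K → x ≤ y + K → K ≤ o + d → x ≤ o + y + d
settle-bound x y o d K x≤y+K K≤o+d = begin
  x           ≤⟨ x≤y+K ⟩
  y + K       ≤⟨ +-monoʳ-≤ y K≤o+d ⟩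
  y + (o + d) ≡⟨ +-assoc y o d ⟨
  y + o + d   ≡⟨ cong (_+ d) (+-comm y o) ⟩
  o + y + d   ∎
  where open ≤-Reasoning

telescope : ∀ m x P P′ K o c d d′ → x + P′ ≤ K * c + K + d′ → m + P + d′ ≤ K * o + P′ + d →
            m + x + P ≤ K * (o + c) + K + d
telescope m x P P′ K o c d d′ later now =
  +-cancelʳ-≤ (P′ + d′) _ _ (subst₂ _≤_ (regroupˡ m x P P′ d′) (regroupʳ K o c d P′ d′) (+-mono-≤ later now))
  where
  regroupˡ : ∀ m x P P′ d′ → x + P′ + (m + P + d′) ≡ m + x + P + (P′ + d′)
  regroupˡ = solve-∀
  regroupʳ : ∀ K o c d P′ d′ → K * c + K + d′ + (K * o + P′ + d) ≡ K * (o + c) + K + d + (P′ + d′)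
  regroupʳ = solve-∀

module UpperBound (k l : ℕ) (1≤l : 1 ≤ l) (l≤k : l ≤ k) where

  -- The prefix lists the pages requested in the current phase, most recent first; while OPT has not
  -- faulted in the phase the credit is 0 and OPT's cache C holds the whole prefix.
  data Credit (C : Cache k) (P : List Page) : ℕ → Set where
    paid   : Credit C P k
    unpaid : P ⊆ₚ pages C → Credit C P 0

  record Phase (C L : Cache k) : Set where
    constructor phase
    field
      prefix   : List Page
      rest     : List Page
      split    : pages L ≡ prefix ++ rest
      credit   : ℕ
      credited : Credit C prefix credit
  open Phase

  prefix≤k : ∀ {C L} (ph : Phase C L) → length (prefix ph) ≤ k
  prefix≤k {L = L} (phase P _ split _ _) =
    subst (length P ≤_) (trans (cong length (sym split)) (size L)) (length-++-≤ˡ P)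

  data Settlement (C : Cache k) (P : List Page) (Q : Query l) : ℕ → Set where
    settled : ∀ {d} → k ≤ k * miss (pages C) (pages Q) + d → Settlement C P Q d
    free    : miss (pages C) (pages Q) ≡ 0 → P ⊆ₚ pages C → pages Q ⊆ₚ pages C → Settlement C P Q 0

  settlement : ∀ {C P d} (Q : Query l) → Credit C P d → Settlement C P Q d
  settlement Q paid = settled (m≤n+m k _)
  settlement {C} Q (unpaid P⊆C) with all? (_∈? pages C) (pages Q)
  ... | yes Q⊆C = free (miss-hit Q⊆C) P⊆C Q⊆C
  ... | no  Q⊈C = settled (subst (λ o → k ≤ k * o + 0) (sym (miss-fault Q⊈C))
                                 (≤-reflexive (sym (trans (+-identityʳ (k * 1)) (*-identityʳ k)))))

  phase-step : ∀ {L C C′} (Q : Query l) → Transition C Q C′ → (ph : Phase C L) →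
    Σ (Phase C′ (lruNext L Q)) λ ph′ →
      miss (pages L) (pages Q) + length (prefix ph) + credit ph′ ≤
      k * miss (pages C) (pages Q) + length (prefix ph′) + credit ph
  phase-step {L} {C} {C′} Q tr (phase P R split d credited) =
    by-cases (length P′ ≤? k) (settlement Q credited)
    where
    m  = miss (pages L) (pages Q)
    o  = miss (pages C) (pages Q)
    P′ = moveToFront (pages Q) P
    P⊆L : P ⊆ₚ pages L
    P⊆L = All.tabulate λ p∈P → subst (_ ∈_) (sym split) (∈-++⁺ˡ p∈P)
    P! : Unique P
    P! = Unique-++⁻ˡ P (subst Unique split (unique L))
    grows : m + length P ≤ length P′
    grows = miss+length≤length-moveToFront (pages Q) P! P⊆L
    restarted : ∃ λ R′ → lruStep (pages L) (pages Q) ≡ pages Q ++ R′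
    restarted = lruStep-restarts (pages L) (pages Q)
      (≤-trans (≤-reflexive (size Q)) (≤-trans l≤k (≤-reflexive (sym (size L)))))
    restart-bound : m + length P + 0 ≤ length (pages Q) + k
    restart-bound = begin
      m + length P + 0         ≡⟨ +-identityʳ _ ⟩
      m + length P             ≤⟨ +-mono-≤ m≤Q (prefix≤k {C} {L} (phase P R split d credited)) ⟩
      length (pages Q) + k     ∎
      where
      open ≤-Reasoning
      m≤Q : m ≤ length (pages Q)
      m≤Q = ≤-trans (miss≤1 (pages L) (pages Q)) (subst (1 ≤_) (sym (size Q)) 1≤l)
    continued : length P′ ≤ k → ∃ λ R′ → lruStep (pages L) (pages Q) ≡ P′ ++ R′
    continued fits = lruStep-continues P R (pages Q) split (subst (length P′ ≤_) (sym (size L)) fits)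
    by-cases : Dec (length P′ ≤ k) → Settlement C P Q d →
      Σ (Phase C′ (lruNext L Q)) λ ph′ → m + length P + credit ph′ ≤ k * o + length (prefix ph′) + d
    by-cases (yes fits) (settled k≤o+d) =
      phase P′ (proj₁ (continued fits)) (proj₂ (continued fits)) k paid ,
      settle-bound _ _ _ d k (+-monoˡ-≤ k grows) k≤o+d
    by-cases (yes fits) (free o≡0 P⊆C Q⊆C) =
      phase P′ (proj₁ (continued fits)) (proj₂ (continued fits)) 0 (unpaid (moveToFront-⊆ (proj₁ tr) P⊆C′)) ,
      subst (λ o → m + length P + 0 ≤ k * o + length P′ + 0) (sym o≡0) (begin
        m + length P + 0       ≡⟨ +-identityʳ _ ⟩
        m + length P           ≤⟨ grows ⟩
        length P′              ≡⟨ +-identityʳ _ ⟨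
        length P′ + 0          ≡⟨ cong (λ z → z + length P′ + 0) (*-zeroʳ k) ⟨
        k * 0 + length P′ + 0  ∎)
      where
      open ≤-Reasoning
      P⊆C′ : P ⊆ₚ pages C′
      P⊆C′ = All.map (All.lookup (hit-keeps-cache {C = C} {C′} {Q} tr Q⊆C)) P⊆C
    by-cases (no overflows) (settled k≤o+d) =
      phase (pages Q) (proj₁ restarted) (proj₂ restarted) 0 (unpaid (proj₁ tr)) ,
      settle-bound _ _ _ d k restart-bound k≤o+d
    by-cases (no overflows) (free _ P⊆C Q⊆C) =
      contradiction (subst (length P′ ≤_) (size C) (pigeonhole P′! (moveToFront-⊆ Q⊆C P⊆C))) overflows
      where P′! = Unique-moveToFront (unique Q) P!

  lru-bound : ∀ {σ} (L C : Cache k) (ph : Phase C L) (S : Schedule C σ) →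
              lruCost (pages L) σ + length (prefix ph) ≤ k * cost S + k + credit ph
  lru-bound L C ph done = begin
    length (prefix ph)     ≤⟨ prefix≤k ph ⟩
    k                      ≤⟨ m≤m+n k (credit ph) ⟩
    k + credit ph          ≡⟨ cong (λ z → z + k + credit ph) (*-zeroʳ k) ⟨
    k * 0 + k + credit ph  ∎
    where open ≤-Reasoning
  lru-bound L C ph (step {Q = Q} {σ} C′ tr S) with phase-step Q tr ph
  ... | ph′ , now =
    telescope (miss (pages L) (pages Q)) (lruCost (pages (lruNext L Q)) σ)
              (length (prefix ph)) (length (prefix ph′)) k (miss (pages C) (pages Q)) (cost S)
              (credit ph) (credit ph′) (lru-bound (lruNext L Q) C′ ph′ S) now

  lru-competitive : ∀ (C₀ : Cache k) (σ : List (Query l)) (S : Schedule C₀ σ) →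
                    lruCost (pages C₀) σ ≤ k * cost S + k
  lru-competitive C₀ σ S =
    subst₂ _≤_ (+-identityʳ _) (+-identityʳ _) (lru-bound C₀ C₀ (phase [] (pages C₀) refl 0 (unpaid [])) S)

theorem3p1 : ∀ (k l : ℕ) → 1 ≤ l → l ≤ k →
    (∀ (A : OnlineAlg k l) (p q : ℕ) → 0 < q → p < (k ∸ l + 1) * q → ¬ AchievesRatio A p q)
    × (∀ (C₀ : Cache k) → ∃ λ c → ∀ (σ : List (Query l)) (S : Schedule C₀ σ) →
         lruCost (pages C₀) σ ≤ k * cost S + c)
theorem3p1 k l 1≤l l≤k =
  (λ A p q _ → no-ratio-below k l 1≤l l≤k A p q) ,
  (λ C₀ → k , UpperBound.lru-competitive k l 1≤l l≤k C₀)
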